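{- Let $x$ and $y$ be representations of a countable set $A$. Then $\mathrm{comp}(x)=\mathrm{comp}(y)$ if and only if both of the following hold: $\mathrm{comp}(x\circ y^{ -1})=\mathrm{comp}(\mathrm{id}_{y(A)})$, where $x\circ y^{ -1}$ and $\mathrm{id}_{y(A)}$ are regarded as representations of the set $y(A)$; and $\mathrm{comp}(y\circ x^{ -1})=\mathrm{comp}(\mathrm{id}_{x(A)})$, where $y\circ x^{ -1}$ and $\mathrm{id}_{x(A)}$ are regarded as representations of the set $x(A)$.
   Context: $\mathbb{T}$ denotes the set of tapes over a fixed finite alphabet with finitely many non-blank symbols. For $Q\subseteq\mathbb{T}$, a function with domain $Q$ and values in $\mathbb{T}$ is computable if some Turing machine, on every input $\tau\in Q$, halts with output equal to the function's value (nothing is required outside $Q$). A representation of a set $S$ is an injective function $s:S\to\mathbb{T}$. For a representation $s$ of $S$, $\mathrm{comp}(s)$ is the set of functions $g$ with domain $S$ and values in $S$ such that $s\circ g\circ s^{ -1}$ (defined on $s(S)$) is computable. This applies also when $S\subseteq\mathbb{T}$ is a set of tapes and $s$ is an injective map $S\to\mathbb{T}$ (an endorepresentation). -}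

module Defs where

open import Data.Nat using (ℕ; zero; suc)
open import Data.Fin using (Fin; zero; suc)
open import Data.Maybe using (Maybe; just; nothing)
open import Data.Product using (Σ; ∃; _×_; _,_; proj₁; proj₂)
open import Relation.Binary.PropositionalEquality using (_≡_)
open import Relation.Unary using (Pred)

-- Alphabet: a fixed finite alphabet  Sym n = Fin (suc n),
-- with the blank symbol  zero  and the non-blank symbols  suc b, b : Fin n.

Sym : ℕ → Set
Sym n = Fin (suc n)

blank : ∀ {n} → Sym n
blank = zero

-- A finite list of cells whose last cell is non-blank (canonical by
-- construction: no trailing blanks, so ≡ is equality of tape contents).
data NE (n : ℕ) : Set where
  last : Fin n → NE n                -- last (non-blank) cell, symbol  suc b
  cons : Sym n → NE n → NE n

-- Half-infinite tape content: all blank (nothing) or a non-empty list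
-- ending in a non-blank cell, followed by infinitely many blanks.
HalfTape : ℕ → Set
HalfTape n = Maybe (NE n)

push : ∀ {n} → Sym n → HalfTape n → HalfTape n
push zero    nothing  = nothing
push (suc b) nothing  = just (last b)
push a       (just r) = just (cons a r)

pop : ∀ {n} → HalfTape n → Sym n × HalfTape n
pop nothing           = blank , nothing
pop (just (last b))   = suc b , nothing
pop (just (cons a r)) = a , just r

record Tape (n : ℕ) : Set where
  constructor tape
  field
    left    : HalfTape n
    current : Sym n
    right   : HalfTape n
open Tape public

data Move : Set where
  L R N : Move

write : ∀ {n} → Sym n → Tape n → Tape n
write a (tape l _ r) = tape l a r

move : ∀ {n} → Move → Tape n → Tape n
move L (tape l c r) with pop l
... | c' , l' = tape l' c' (push c r)
move R (tape l c r) with pop r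
... | c' , r' = tape (push c l) c' r'
move N t = t

-- Turing machines over the alphabet Sym n.
-- States Fin (suc states), start state zero; δ q a = nothing means halt.

record TM (n : ℕ) : Set where
  field
    states : ℕ
    δ      : Fin (suc states) → Sym n → Maybe (Fin (suc states) × Sym n × Move)

Config : ∀ {n} → TM n → Set
Config {n} M = Fin (suc (TM.states M)) × Tape n

-- run for at most k steps; just t = the machine has halted with tape t
runFor : ∀ {n} (M : TM n) → ℕ → Config M → Maybe (Tape n)
runFor M zero    _       = nothing
runFor M (suc k) (q , t) with TM.δ M q (current t)
... | nothing           = just t
... | just (q' , a , m) = runFor M k (q' , move m (write a t))

HaltsWith : ∀ {n} → TM n → Tape n → Tape n → Set
HaltsWith M τ τ' = ∃ λ k → runFor M k (zero , τ) ≡ just τ'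

Computable : ∀ n (Q : Tape n → Set) → ((τ : Tape n) → Q τ → Tape n) → Set
Computable n Q f = Σ (TM n) λ M → ∀ τ (q : Q τ) → HaltsWith M τ (f τ q)

Image : ∀ {n} {S : Set} → (S → Tape n) → Tape n → Set
Image {S = S} s τ = Σ S λ a → s a ≡ τ

ImageSet : ∀ {n} {S : Set} → (S → Tape n) → Set
ImageSet {n} s = Σ (Tape n) (Image s)

-- comp(s) = { g : S → S | s ∘ g ∘ s⁻¹ (defined on s(S)) is computable }
comp : ∀ n {S : Set} → (S → Tape n) → Pred (S → S) _
comp n s g = Computable n (Image s) (λ τ q → s (g (proj₁ q)))

_∘inv_ : ∀ {n} {A : Set} → (A → Tape n) → (y : A → Tape n) → ImageSet y → Tape n
(x ∘inv y) (τ , a , _) = x a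

idImage : ∀ {n} {A : Set} (y : A → Tape n) → ImageSet y → Tape n
idImage y = proj₁

Countable : Set → Set
Countable A = Σ (A → ℕ) λ f → ∀ {a b} → f a ≡ f b → a ≡ b

module Submission where

-- The set y(A) is, as a type, ImageSet y, whose elements
-- (τ , a , p) carry a preimage a.  The maps  ι a = (y a , a , refl)  and
-- π (τ , a , p) = a  are mutually inverse (ι ∘ π = id by matching on p), so
-- a function h on y(A) corresponds to the function  π ∘ h ∘ ι  on A.
-- Computability is invariant under such a change of index set: for any
-- representation r of y(A),  h ∈ comp(r)  iff  π ∘ h ∘ ι ∈ comp(r ∘ ι).
-- Since (x ∘ y⁻¹) ∘ ι = x and id_{y(A)} ∘ ι = y definitionally, this gives
--   comp(x) ≐ comp(y)  ⇔  comp(x ∘ y⁻¹) ≐ comp(id_{y(A)}),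
-- and, exchanging x and y,  comp(y) ≐ comp(x) ⇔ comp(y ∘ x⁻¹) ≐ comp(id_{x(A)}).
-- The corollary combines these two equivalences.  The argument does not use
-- injectivity of x, y or countability of A: the preimage is part of each
-- element of ImageSet y.

open import Defs
open import Data.Nat using (ℕ)
open import Data.Product using (_×_; _,_)
open import Function.Base using (_∘_)
open import Function.Bundles using (_⇔_; mk⇔; Equivalence)
open import Function.Definitions using (Injective)
open import Relation.Binary.PropositionalEquality
  using (_≡_; refl; sym; trans; cong; subst)
open import Relation.Unary using (Pred; _⊆_; _≐_)
open import Relation.Unary.Properties using (≐-sym)

computable-reindex : ∀ {n} {Q Q' : Tape n → Set}
  {f : ∀ τ → Q τ → Tape n} {f' : ∀ τ → Q' τ → Tape n} →
  (φ : ∀ {τ} → Q' τ → Q τ) → (∀ τ q' → f τ (φ q') ≡ f' τ q') →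
  Computable n Q f → Computable n Q' f'
computable-reindex φ agree (M , halts) =
  M , λ τ q' → subst (HaltsWith M τ) (agree τ q') (halts τ (φ q'))

module Reparametrise {n : ℕ} {A S : Set} (r : S → Tape n)
  (e : A → S) (p : S → A) (e∘p : ∀ s → e (p s) ≡ s) where

  comp-reparametrise : ∀ h → comp n r h ⇔ comp n (r ∘ e) (p ∘ h ∘ e)
  comp-reparametrise h = mk⇔ to from
    where
    -- An input r (e a) is one of r; the outputs agree since e ∘ p = id.
    to : comp n r h → comp n (r ∘ e) (p ∘ h ∘ e)
    to = computable-reindex (λ (a , eq) → e a , eq)
           (λ _ (a , _) → cong r (sym (e∘p (h (e a)))))

    -- An input r s is also r (e (p s)), on which both outputs agree.
    e∘p-agrees : ∀ s → r (e (p (h (e (p s))))) ≡ r (h s)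
    e∘p-agrees s = cong r (trans (e∘p (h (e (p s)))) (cong h (e∘p s)))

    from : comp n (r ∘ e) (p ∘ h ∘ e) → comp n r h
    from = computable-reindex
             (λ (s , eq) → p s , trans (cong r (e∘p s)) eq)
             (λ _ (s , _) → e∘p-agrees s)

module _ {n : ℕ} {A : Set} (y : A → Tape n) where

  ι : A → ImageSet y
  ι a = y a , a , refl

  π : ImageSet y → A
  π (_ , a , _) = a

  ι∘π : ∀ t → ι (π t) ≡ t
  ι∘π (_ , _ , refl) = refl

  comp-image : (r : ImageSet y → Tape n) →
    ∀ h → comp n r h ⇔ comp n (r ∘ ι) (π ∘ h ∘ ι)
  comp-image r = Reparametrise.comp-reparametrise r ι π ι∘π

≐-conjugate : ∀ {ℓ} {A S : Set} {P Q : Pred (A → A) ℓ} {P' Q' : Pred (S → S) ℓ}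
  (pull : (S → S) → (A → A)) (push : (A → A) → (S → S)) →
  (∀ g → pull (push g) ≡ g) →
  (∀ h → P' h ⇔ P (pull h)) → (∀ h → Q' h ⇔ Q (pull h)) →
  (P ≐ Q) ⇔ (P' ≐ Q')
≐-conjugate {ℓ} {A} {S} {P} {Q} {P'} {Q'} pull push pull∘push P'≈ Q'≈ =
  mk⇔ (λ (P⊆Q , Q⊆P) → lift {P} {Q} P'≈ Q'≈ P⊆Q , lift {Q} {P} Q'≈ P'≈ Q⊆P)
      (λ (P'⊆Q' , Q'⊆P') → descend {P} {Q} P'≈ Q'≈ P'⊆Q' , descend {Q} {P} Q'≈ P'≈ Q'⊆P')
  where
  open Equivalence using (to; from)

  lift : ∀ {U V : Pred (A → A) ℓ} {U' V' : Pred (S → S) ℓ} →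
         (∀ h → U' h ⇔ U (pull h)) → (∀ h → V' h ⇔ V (pull h)) →
         U ⊆ V → U' ⊆ V'
  lift U'≈ V'≈ U⊆V {h} = from (V'≈ h) ∘ U⊆V ∘ to (U'≈ h)

  -- An inclusion upstairs descends, testing g on its image  push g.
  descend : ∀ {U V : Pred (A → A) ℓ} {U' V' : Pred (S → S) ℓ} →
            (∀ h → U' h ⇔ U (pull h)) → (∀ h → V' h ⇔ V (pull h)) →
            U' ⊆ V' → U ⊆ V
  descend {U = U} {V} U'≈ V'≈ U'⊆V' {g} Ug =
    subst V (pull∘push g)
      (to (V'≈ (push g)) (U'⊆V' (from (U'≈ (push g)) (subst U (sym (pull∘push g)) Ug))))

-- Conjugation by ι, π
-- has the section g ↦ ι ∘ g ∘ π, and (x ∘ y⁻¹) ∘ ι = x, id_{y(A)} ∘ ι = y.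
comp≐⇔comp-image≐ : ∀ n {A : Set} (x y : A → Tape n) →
  (comp n x ≐ comp n y) ⇔ (comp n (x ∘inv y) ≐ comp n (idImage y))
comp≐⇔comp-image≐ n x y =
  ≐-conjugate (λ h → π y ∘ h ∘ ι y) (λ g → ι y ∘ g ∘ π y) (λ _ → refl)
    (comp-image y (x ∘inv y)) (comp-image y (idImage y))

-- The corollary: apply the core equivalence to (x, y) and to (y, x); the
-- second component is only needed in the forward direction.
corollary1 : (n : ℕ) {A : Set} (x y : A → Tape n) →
    Countable A → Injective _≡_ _≡_ x → Injective _≡_ _≡_ y →
    ((comp n x ≐ comp n y) ⇔
      ((comp n (x ∘inv y) ≐ comp n (idImage y)) ×
       (comp n (y ∘inv x) ≐ comp n (idImage x))))
corollary1 n x y _ _ _ =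
  mk⇔ (λ x≐y → to via-y x≐y , to via-x (≐-sym x≐y))
      (λ (image-y , _) → from via-y image-y)
  where
  open Equivalence using (to; from)

  via-y : (comp n x ≐ comp n y) ⇔ (comp n (x ∘inv y) ≐ comp n (idImage y))
  via-y = comp≐⇔comp-image≐ n x y

  via-x : (comp n y ≐ comp n x) ⇔ (comp n (y ∘inv x) ≐ comp n (idImage x))
  via-x = comp≐⇔comp-image≐ n y x
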